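{- Let $n$ be a positive multiple of $3$. Then there exists an orientation of the $n$-dimensional hypercube $Q_n$ that is $(2,3)$-cordial.
   Context: The $n$-dimensional hypercube $Q_n$ has vertex set $\{0,1\}^n$, two vertices adjacent iff they differ in exactly one coordinate. An oriented hypercube is a digraph obtained by assigning to each edge of $Q_n$ exactly one direction. A labeling $f:V\to\{0,1\}$ is friendly if $-1\le |f^{ -1}(0)|-|f^{ -1}(1)|\le 1$. For a digraph $D=(V,A)$ and $f:V\to\{0,1\}$, the induced arc labeling is $g:A\to\{1,-1,0\}$, $g(\overrightarrow{uv})=f(v)-f(u)$ for the arc from $u$ to $v$. $D$ is $(2,3)$-cordial if there exists a friendly $f$ such that for all $i,j\in\{1,-1,0\}$, $-1\le |g^{ -1}(i)|-|g^{ -1}(j)|\le 1$. -}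

module Defs where

open import Data.Bool using (Bool; true; false; if_then_else_)
open import Data.Nat using (ℕ; zero; suc; _≤_; _+_)
open import Data.Fin using (Fin)
open import Data.Vec using (Vec; []; _∷_; lookup; updateAt)
open import Data.List using (List; []; _∷_; map; concatMap; length; filter; allFin)
open import Data.Integer using (ℤ; +_; _-_)
open import Data.Product using (_×_; _,_; proj₁; proj₂)
open import Relation.Binary.PropositionalEquality using (_≡_)
import Data.Integer.Properties as ℤP
import Data.Bool.Properties as BP
open import Relation.Unary using (Pred; Decidable)
open import Relation.Nullary using (Dec; does; ¬_)
open import Relation.Nullary.Decidable using (¬?)

Vertex : ℕ → Set
Vertex n = Vec Bool n

allVertices : (n : ℕ) → List (Vertex n)
allVertices zero = [] ∷ []
allVertices (suc n) = concatMap (λ v → (false ∷ v) ∷ (true ∷ v) ∷ []) (allVertices n)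

flip : ∀ {n} → Fin n → Vertex n → Vertex n
flip i v = updateAt v i Data.Bool.not

-- Each edge of Q_n is represented exactly once as a pair (v , i)
-- with the i-th coordinate of v equal to 0; the edge is {v , flip i v}.
Edge : ℕ → Set
Edge n = Vertex n × Fin n

allEdges : (n : ℕ) → List (Edge n)
allEdges n = filter (λ e → ¬? (lookup (proj₁ e) (proj₂ e) BP.≟ true))
                    (concatMap (λ v → map (λ i → v , i) (allFin n)) (allVertices n))

-- An orientation of Q_n assigns to each edge (v , i) (with v_i = 0) a direction:
-- true means the arc v → flip i v, false means flip i v → v.
-- (Values at pairs with v_i = 1 are irrelevant and never used.)
Orientation : ℕ → Set
Orientation n = Vertex n → Fin n → Bool

arcs : ∀ {n} → Orientation n → List (Vertex n × Vertex n)
arcs {n} o = map (λ e → let v = proj₁ e ; i = proj₂ e in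
                        if o v i then (v , flip i v) else (flip i v , v))
                 (allEdges n)

Labeling : ℕ → Set
Labeling n = Vertex n → Bool

toℤ : Bool → ℤ
toℤ false = + 0
toℤ true = + 1

Close : ℕ → ℕ → Set
Close a b = (a ≤ suc b) × (b ≤ suc a)

count : ∀ {A : Set} → (A → Bool) → List A → ℕ
count p xs = length (filter (λ x → Data.Bool._≟_ (p x) true) xs)

vcount : ∀ {n} → Labeling n → Bool → ℕ
vcount {n} f b = count (λ v → does (f v BP.≟ b)) (allVertices n)

Friendly : ∀ {n} → Labeling n → Set
Friendly f = Close (vcount f false) (vcount f true)

arcLabel : ∀ {n} → Labeling n → Vertex n × Vertex n → ℤ
arcLabel f (u , v) = toℤ (f v) - toℤ (f u)

acount : ∀ {n} → Orientation n → Labeling n → ℤ → ℕ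
acount o f k = count (λ a → does (arcLabel f a ℤP.≟ k)) (arcs o)

Cordial23 : ∀ {n} → Orientation n → Set
Cordial23 o = Data.Product.∃ λ f → Friendly f
  × Close (acount o f (+ 1)) (acount o f (Data.Integer.-[1+ 0 ]))
  × Close (acount o f (+ 1)) (acount o f (+ 0))
  × Close (acount o f (Data.Integer.-[1+ 0 ])) (acount o f (+ 0))

module Submission where

-- Split the 3m coordinates into m triples (a, b, c) and label a vertex by the parity
-- of its a- and b-coordinates. Flipping the first coordinate toggles this label, so it
-- is friendly. Crossing an a- or b-edge changes the label and crossing a c-edge does
-- not; orienting a-edges from label 0 to 1 and b-edges from 1 to 0 makes the label of
-- an arc depend only on the type of its direction: 1, -1 or 0. Every direction carries
-- 2^(n-1) edges, so each arc label occurs exactly m 2^(n-1) times.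

open import Defs
open import Data.Nat using (ℕ; zero; suc; _+_; _*_; _^_)
open import Data.Product using (∃; _×_; _,_; proj₂; uncurry)

open import Data.Bool using (Bool; true; false; not; _∧_; _xor_; if_then_else_)
import Data.Bool.Properties as Bool
open import Data.Bool.Properties using (not-distribˡ-xor; not-distribʳ-xor; if-float)
open import Data.Nat.ListAction using (sum)
open import Data.Nat.Properties using (*-cancelˡ-≡; *-comm; n≤1+n)
open import Data.Nat.Solver using (module +-*-Solver)
open import Data.Fin using (Fin) renaming (zero to fzero; suc to fsuc)
open import Data.Vec using ([]; _∷_; lookup)
open import Data.List using (List; []; _∷_; [_]; _++_; map; concatMap; length; filter; allFin; tabulate)
open import Data.List.Properties using (filter-++; length-++; map-tabulate; map-cong)
open import Data.Integer using (ℤ; _-_)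
import Data.Integer as ℤ
open import Level using (0ℓ)
open import Function using (_∘_; id)
open import Relation.Binary.PropositionalEquality using (_≡_; refl; sym; trans; cong; cong₂; subst; module ≡-Reasoning)
open import Relation.Nullary using (does)
open import Relation.Nullary.Decidable using (¬?)
open import Relation.Unary using (Pred; Decidable)

open +-*-Solver using (solve; _:+_; _:*_; _:=_; con)
open ≡-Reasoning

module _ {A : Set} (p : A → Bool) where

  count-++ : ∀ xs ys → count p (xs ++ ys) ≡ count p xs + count p ys
  count-++ xs ys = trans (cong length (filter-++ _ xs ys)) (length-++ (filter _ xs))

  count-∷ : ∀ x xs → count p (x ∷ xs) ≡ count p [ x ] + count p xs
  count-∷ x = count-++ [ x ]

  count-concatMap : ∀ {B : Set} (h : B → List A) xs →
    count p (concatMap h xs) ≡ sum (map (count p ∘ h) xs)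
  count-concatMap h [] = refl
  count-concatMap h (x ∷ xs) =
    trans (count-++ (h x) (concatMap h xs)) (cong (count p (h x) +_) (count-concatMap h xs))

count-map : ∀ {A B : Set} (p : B → Bool) (g : A → B) xs → count p (map g xs) ≡ count (p ∘ g) xs
count-map p g [] = refl
count-map p g (x ∷ xs) with p (g x)
... | true  = cong suc (count-map p g xs)
... | false = count-map p g xs

count-cong : ∀ {A : Set} {p q : A → Bool} → (∀ x → p x ≡ q x) → ∀ xs → count p xs ≡ count q xs
count-cong p≗q [] = refl
count-cong {p = p} {q} p≗q (x ∷ xs) with p x | q x | p≗q x
... | true  | .true  | refl = cong suc (count-cong p≗q xs)
... | false | .false | refl = count-cong p≗q xs

count-singleton : ∀ {A : Set} {p q : A → Bool} {x : A} → p x ≡ q x → count p [ x ] ≡ count q [ x ]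
count-singleton {p = p} {q} {x} px≡qx with p x | q x | px≡qx
... | true  | .true  | refl = refl
... | false | .false | refl = refl

count-filter : ∀ {A : Set} {P : Pred A 0ℓ} (P? : Decidable P) (p : A → Bool) xs →
  count p (filter P? xs) ≡ count (λ x → does (P? x) ∧ p x) xs
count-filter P? p [] = refl
count-filter P? p (x ∷ xs) with does (P? x)
... | false = count-filter P? p xs
... | true with p x
...   | true  = cong suc (count-filter P? p xs)
...   | false = count-filter P? p xs

count-allFin-suc : ∀ {n} (P : Fin (suc n) → Bool) →
  count P (allFin (suc n)) ≡ count P [ fzero ] + count (P ∘ fsuc) (allFin n)
count-allFin-suc {n} P = begin
  count P (allFin (suc n))                          ≡⟨ count-∷ P fzero (tabulate fsuc) ⟩
  count P [ fzero ] + count P (tabulate fsuc)       ≡⟨ cong (λ is → count P [ fzero ] + count P is) (map-tabulate id fsuc) ⟨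
  count P [ fzero ] + count P (map fsuc (allFin n)) ≡⟨ cong (count P [ fzero ] +_) (count-map P fsuc (allFin n)) ⟩
  count P [ fzero ] + count (P ∘ fsuc) (allFin n)   ∎

extensions : ∀ {n} → Vertex n → List (Vertex (suc n))
extensions v = (false ∷ v) ∷ (true ∷ v) ∷ []

length-concatMap-extensions : ∀ {n} (vs : List (Vertex n)) →
  length (concatMap extensions vs) ≡ 2 * length vs
length-concatMap-extensions [] = refl
length-concatMap-extensions (v ∷ vs) rewrite length-concatMap-extensions vs =
  solve 1 (λ l → con 2 :+ con 2 :* l := con 2 :* (con 1 :+ l)) refl (length vs)

length-allVertices : ∀ n → length (allVertices n) ≡ 2 ^ n
length-allVertices zero = refl
length-allVertices (suc n) =
  trans (length-concatMap-extensions (allVertices n)) (cong (2 *_) (length-allVertices n))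

upward : ∀ {n} → (Fin n → Bool) → Vertex n → Fin n → Bool
upward P v i = not (lookup v i) ∧ P i

upDegree : ∀ {n} → (Fin n → Bool) → Vertex n → ℕ
upDegree P v = count (upward P v) (allFin _)

upDegree-false : ∀ {n} (P : Fin (suc n) → Bool) (v : Vertex n) →
  upDegree P (false ∷ v) ≡ count P [ fzero ] + upDegree (P ∘ fsuc) v
upDegree-false P v = trans (count-allFin-suc (upward P (false ∷ v)))
  (cong (_+ upDegree (P ∘ fsuc) v) (count-singleton {p = upward P (false ∷ v)} {q = P} refl))

upDegree-true : ∀ {n} (P : Fin (suc n) → Bool) (v : Vertex n) →
  upDegree P (true ∷ v) ≡ upDegree (P ∘ fsuc) v
upDegree-true P v = count-allFin-suc (upward P (true ∷ v))

sum-upDegree-extensions : ∀ {n} (P : Fin (suc n) → Bool) (vs : List (Vertex n)) →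
  sum (map (upDegree P) (concatMap extensions vs))
    ≡ length vs * count P [ fzero ] + 2 * sum (map (upDegree (P ∘ fsuc)) vs)
sum-upDegree-extensions P [] = refl
sum-upDegree-extensions P (v ∷ vs)
  rewrite upDegree-false P v | upDegree-true P v | sum-upDegree-extensions P vs =
  solve 4 (λ a u l s → a :+ u :+ (u :+ (l :* a :+ con 2 :* s)) := (con 1 :+ l) :* a :+ con 2 :* (u :+ s))
    refl (count P [ fzero ]) (upDegree (P ∘ fsuc) v) (length vs) (sum (map (upDegree (P ∘ fsuc)) vs))

sum-upDegree : ∀ n (P : Fin n → Bool) →
  2 * sum (map (upDegree P) (allVertices n)) ≡ 2 ^ n * count P (allFin n)
sum-upDegree zero P = refl
sum-upDegree (suc n) P = begin
  2 * sum (map (upDegree P) (allVertices (suc n)))   ≡⟨ cong (2 *_) (sum-upDegree-extensions P (allVertices n)) ⟩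
  2 * (length (allVertices n) * a + 2 * s)           ≡⟨ cong (λ l → 2 * (l * a + 2 * s)) (length-allVertices n) ⟩
  2 * (2 ^ n * a + 2 * s)                            ≡⟨ cong (λ t → 2 * (2 ^ n * a + t)) (sum-upDegree n (P ∘ fsuc)) ⟩
  2 * (2 ^ n * a + 2 ^ n * c)                        ≡⟨ solve 3 (λ x a c → con 2 :* (x :* a :+ x :* c) := (con 2 :* x) :* (a :+ c)) refl (2 ^ n) a c ⟩
  2 ^ suc n * (a + c)                                ≡⟨ cong (2 ^ suc n *_) (count-allFin-suc P) ⟨
  2 ^ suc n * count P (allFin (suc n))               ∎
  where
  a s c : ℕ
  a = count P [ fzero ]
  s = sum (map (upDegree (P ∘ fsuc)) (allVertices n))
  c = count (P ∘ fsuc) (allFin n)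

does-¬?-≟-true : ∀ b → does (¬? (b Bool.≟ true)) ≡ not b
does-¬?-≟-true true  = refl
does-¬?-≟-true false = refl

count-allEdges≡sum-upDegree : ∀ n (P : Fin n → Bool) →
  count (P ∘ proj₂) (allEdges n) ≡ sum (map (upDegree P) (allVertices n))
count-allEdges≡sum-upDegree n P = begin
  count (P ∘ proj₂) (allEdges n)
    ≡⟨ count-filter _ (P ∘ proj₂) edgeCandidates ⟩
  count (λ (v , i) → does (¬? (lookup v i Bool.≟ true)) ∧ P i) edgeCandidates
    ≡⟨ count-cong (λ (v , i) → cong (_∧ P i) (does-¬?-≟-true (lookup v i))) edgeCandidates ⟩
  count (uncurry (upward P)) edgeCandidates
    ≡⟨ count-concatMap _ _ (allVertices n) ⟩
  sum (map (λ v → count (uncurry (upward P)) (map (v ,_) (allFin n))) (allVertices n))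
    ≡⟨ cong sum (map-cong (λ v → count-map _ (v ,_) (allFin n)) (allVertices n)) ⟩
  sum (map (upDegree P) (allVertices n)) ∎
  where
  edgeCandidates : List (Edge n)
  edgeCandidates = concatMap (λ v → map (v ,_) (allFin n)) (allVertices n)

count-allEdges : ∀ n (P : Fin n → Bool) →
  2 * count (P ∘ proj₂) (allEdges n) ≡ 2 ^ n * count P (allFin n)
count-allEdges n P = trans (cong (2 *_) (count-allEdges≡sum-upDegree n P)) (sum-upDegree n P)

module _ {n} (f : Labeling (suc n)) (flips : ∀ v → f (true ∷ v) ≡ not (f (false ∷ v))) where

  hasLabel : Bool → Vertex (suc n) → Bool
  hasLabel b v = does (f v Bool.≟ b)

  count-extensions : ∀ b v → count (hasLabel b) (extensions v) ≡ 1
  count-extensions b v = trans (count-∷ (hasLabel b) (false ∷ v) [ true ∷ v ]) (split b)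
    where
    split : ∀ b → count (hasLabel b) [ false ∷ v ] + count (hasLabel b) [ true ∷ v ] ≡ 1
    split b with f (false ∷ v) | f (true ∷ v) | flips v | b
    ... | false | .true  | refl | false = refl
    ... | false | .true  | refl | true  = refl
    ... | true  | .false | refl | false = refl
    ... | true  | .false | refl | true  = refl

  count-concatMap-extensions : ∀ b vs → count (hasLabel b) (concatMap extensions vs) ≡ length vs
  count-concatMap-extensions b [] = refl
  count-concatMap-extensions b (v ∷ vs) =
    trans (count-++ (hasLabel b) (extensions v) (concatMap extensions vs))
          (cong₂ _+_ (count-extensions b v) (count-concatMap-extensions b vs))

  vcount-balanced : ∀ b → vcount f b ≡ 2 ^ n
  vcount-balanced b = trans (count-concatMap-extensions b (allVertices n)) (length-allVertices n)

arc : ∀ {n} → Orientation n → Edge n → Vertex n × Vertex n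
arc o (v , i) = if o v i then (v , flip i v) else (flip i v , v)

acount-byDirection : ∀ {n} (o : Orientation n) (f : Labeling n) (κ : Fin n → ℤ) →
  (∀ v i → arcLabel f (arc o (v , i)) ≡ κ i) →
  ∀ ℓ → 2 * acount o f ℓ ≡ 2 ^ n * count (λ i → does (κ i ℤ.≟ ℓ)) (allFin n)
acount-byDirection {n} o f κ arcLabel≡κ ℓ = begin
  2 * acount o f ℓ
    ≡⟨ cong (2 *_) (count-map _ (arc o) (allEdges n)) ⟩
  2 * count (λ e → does (arcLabel f (arc o e) ℤ.≟ ℓ)) (allEdges n)
    ≡⟨ cong (2 *_) (count-cong (λ (v , i) → cong (λ z → does (z ℤ.≟ ℓ)) (arcLabel≡κ v i)) (allEdges n)) ⟩
  2 * count ((λ i → does (κ i ℤ.≟ ℓ)) ∘ proj₂) (allEdges n)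
    ≡⟨ count-allEdges n _ ⟩
  2 ^ n * count (λ i → does (κ i ℤ.≟ ℓ)) (allFin n) ∎

data Role : Set where
  rising falling level : Role

slope : Role → ℤ
slope rising  = ℤ.+ 1
slope falling = ℤ.-[1+ 0 ]
slope level   = ℤ.+ 0

across : Role → Bool → Bool
across rising  = not
across falling = not
across level   = id

orient : Role → Bool → Bool
orient rising  x = not x
orient falling x = x
orient level   _ = true

oriented-difference : ∀ r x →
  (if orient r x then toℤ (across r x) - toℤ x else toℤ x - toℤ (across r x)) ≡ slope r
oriented-difference rising  false = refl
oriented-difference rising  true  = refl
oriented-difference falling false = refl
oriented-difference falling true  = refl
oriented-difference level   false = refl
oriented-difference level   true  = refl

arcLabel-orient : ∀ {n} (f : Labeling n) r {u w : Vertex n} → f w ≡ across r (f u) →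
  arcLabel f (if orient r (f u) then (u , w) else (w , u)) ≡ slope r
arcLabel-orient f r {u} {w} fw = begin
  arcLabel f (if orient r (f u) then (u , w) else (w , u))
    ≡⟨ if-float (arcLabel f) (orient r (f u)) ⟩
  (if orient r (f u) then toℤ (f w) - toℤ (f u) else toℤ (f u) - toℤ (f w))
    ≡⟨ cong (λ y → if orient r (f u) then toℤ y - toℤ (f u) else toℤ (f u) - toℤ y) fw ⟩
  (if orient r (f u) then toℤ (across r (f u)) - toℤ (f u) else toℤ (f u) - toℤ (across r (f u)))
    ≡⟨ oriented-difference r (f u) ⟩
  slope r ∎

-- Dimension m * 3 rather than 3 * m, so that suc m * 3 reduces to 3 + m * 3.
role : ∀ m → Fin (m * 3) → Role
role (suc m) fzero                  = rising
role (suc m) (fsuc fzero)           = falling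
role (suc m) (fsuc (fsuc fzero))    = level
role (suc m) (fsuc (fsuc (fsuc i))) = role m i

parity : ∀ m → Labeling (m * 3)
parity zero    []              = false
parity (suc m) (a ∷ b ∷ _ ∷ v) = a xor (b xor parity m v)

orientation : ∀ m → Orientation (m * 3)
orientation m v i = orient (role m i) (parity m v)

xor-across : ∀ r a x → a xor across r x ≡ across r (a xor x)
xor-across rising  a x = sym (not-distribʳ-xor a x)
xor-across falling a x = sym (not-distribʳ-xor a x)
xor-across level   a x = refl

parity-flip : ∀ m i v → parity m (flip i v) ≡ across (role m i) (parity m v)
parity-flip (suc m) fzero (a ∷ b ∷ _ ∷ v) = sym (not-distribˡ-xor a (b xor parity m v))
parity-flip (suc m) (fsuc fzero) (a ∷ b ∷ _ ∷ v) = begin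
  a xor (not b xor parity m v)   ≡⟨ cong (a xor_) (not-distribˡ-xor b (parity m v)) ⟨
  a xor not (b xor parity m v)   ≡⟨ not-distribʳ-xor a (b xor parity m v) ⟨
  not (a xor (b xor parity m v)) ∎
parity-flip (suc m) (fsuc (fsuc fzero)) (a ∷ b ∷ _ ∷ v) = refl
parity-flip (suc m) (fsuc (fsuc (fsuc i))) (a ∷ b ∷ _ ∷ v) = begin
  a xor (b xor parity m (flip i v))        ≡⟨ cong (λ x → a xor (b xor x)) (parity-flip m i v) ⟩
  a xor (b xor across r (parity m v))      ≡⟨ cong (a xor_) (xor-across r b (parity m v)) ⟩
  a xor across r (b xor parity m v)        ≡⟨ xor-across r a (b xor parity m v) ⟩
  across r (a xor (b xor parity m v))      ∎
  where
  r : Role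
  r = role m i

arcLabel-parity : ∀ m v i → arcLabel (parity m) (arc (orientation m) (v , i)) ≡ slope (role m i)
arcLabel-parity m v i = arcLabel-orient (parity m) (role m i) (parity-flip m i v)

count-role : ∀ m r → count (λ i → does (slope (role m i) ℤ.≟ slope r)) (allFin (m * 3)) ≡ m
count-role zero    r = refl
count-role (suc m) r = begin
  count (hits r) (allFin (suc m * 3))
    ≡⟨ count-allFin-suc (hits r) ⟩
  c₀ r + count (hits r ∘ fsuc) (allFin (suc (suc (m * 3))))
    ≡⟨ cong (c₀ r +_) (count-allFin-suc (hits r ∘ fsuc)) ⟩
  c₀ r + (c₁ r + count (hits r ∘ fsuc ∘ fsuc) (allFin (suc (m * 3))))
    ≡⟨ cong (λ z → c₀ r + (c₁ r + z)) (count-allFin-suc (hits r ∘ fsuc ∘ fsuc)) ⟩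
  c₀ r + (c₁ r + (c₂ r + count (hits r ∘ fsuc ∘ fsuc ∘ fsuc) (allFin (m * 3))))
    ≡⟨ cong (λ z → c₀ r + (c₁ r + (c₂ r + z))) (count-role m r) ⟩
  c₀ r + (c₁ r + (c₂ r + m))
    ≡⟨ one-role-per-slope r ⟩
  suc m ∎
  where
  hits : Role → Fin (suc m * 3) → Bool
  hits r′ i = does (slope (role (suc m) i) ℤ.≟ slope r′)
  c₀ c₁ c₂ : Role → ℕ
  c₀ r′ = count (hits r′) [ fzero ]
  c₁ r′ = count (hits r′ ∘ fsuc) [ fzero ]
  c₂ r′ = count (hits r′ ∘ fsuc ∘ fsuc) [ fzero ]
  one-role-per-slope : ∀ r′ → c₀ r′ + (c₁ r′ + (c₂ r′ + m)) ≡ suc m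
  one-role-per-slope rising  = refl
  one-role-per-slope falling = refl
  one-role-per-slope level   = refl

acount-slope : ∀ m r → 2 * acount (orientation m) (parity m) (slope r) ≡ 2 ^ (m * 3) * m
acount-slope m r =
  trans (acount-byDirection (orientation m) (parity m) (slope ∘ role m) (arcLabel-parity m) (slope r))
        (cong (2 ^ (m * 3) *_) (count-role m r))

acount-slope-independent : ∀ m r r′ →
  acount (orientation m) (parity m) (slope r) ≡ acount (orientation m) (parity m) (slope r′)
acount-slope-independent m r r′ = *-cancelˡ-≡ _ _ 2 (trans (acount-slope m r) (sym (acount-slope m r′)))

parity-flips : ∀ m v → parity (suc m) (true ∷ v) ≡ not (parity (suc m) (false ∷ v))
parity-flips m (b ∷ _ ∷ v) = refl

close-≡ : ∀ {a b} → a ≡ b → Close a b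
close-≡ {a} refl = n≤1+n a , n≤1+n a

orientation-cordial : ∀ m → Cordial23 (orientation (suc m))
orientation-cordial m = parity (suc m)
  , close-≡ (trans (balanced false) (sym (balanced true)))
  , close-≡ (acount-slope-independent (suc m) rising falling)
  , close-≡ (acount-slope-independent (suc m) rising level)
  , close-≡ (acount-slope-independent (suc m) falling level)
  where
  balanced : ∀ b → vcount (parity (suc m)) b ≡ 2 ^ suc (suc (m * 3))
  balanced = vcount-balanced (parity (suc m)) (parity-flips m)

theorem1 : (k : ℕ) → ∃ λ (o : Orientation (3 * suc k)) → Cordial23 o
theorem1 k = subst (λ n → ∃ λ (o : Orientation n) → Cordial23 o) (*-comm (suc k) 3)
  (orientation (suc k) , orientation-cordial k)
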